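{- Let $n \ge 1$ and $\Sigma = \{0,1,2\}$. Let $T_n$ be the number of integer arrays $\pi$ of length $n$ such that $\pi = \pi_x$ for some word $x \in \Sigma^n$. Then $T_n \le \frac{3^{n-1}+1}{2}$.
   Context: For a finite alphabet $\Sigma$, two words over $\Sigma$ of equal length are abelian equivalent if every letter of $\Sigma$ occurs the same number of times in both. An abelian border of a word $w$ is a proper prefix of $w$ (a prefix different from $w$, possibly empty) that is abelian equivalent to the suffix of $w$ of the same length. For a word $x$ of length $n$, the abelian border array $\pi_x$ is the array of length $n$ with $\pi_x[i]$ ($1\le i\le n$) equal to the length of the longest abelian border of the prefix $x[1]\cdots x[i]$. -}

module Defs where

open import Data.Nat using (ℕ; zero; suc; _∸_)
open import Data.Fin using (Fin)
open import Data.Fin.Properties using (all?) renaming (_≟_ to _≟ᶠ_)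
open import Data.List using (List; []; _∷_; length; take; drop; map; concatMap; allFin; deduplicate; applyUpTo)
open import Data.List.Properties using (≡-dec)
open import Data.Nat.Properties using () renaming (_≟_ to _≟ℕ_)
open import Relation.Binary.PropositionalEquality using (_≡_)
open import Relation.Nullary using (Dec; yes; no; does)
open import Data.Product using (_×_)
open import Relation.Nullary.Decidable using (_×-dec_)
open import Data.Bool using (if_then_else_)

Σ : Set
Σ = Fin 3

Word : Set
Word = List Σ

count : Σ → Word → ℕ
count a [] = 0
count a (b ∷ w) with does (a ≟ᶠ b)
... | Data.Bool.true  = suc (count a w)
... | Data.Bool.false = count a w

AbelianEq : Word → Word → Set
AbelianEq u v = (length u ≡ length v) × (∀ a → count a u ≡ count a v)

abelianEq? : (u v : Word) → Dec (AbelianEq u v)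
abelianEq? u v = (length u ≟ℕ length v) ×-dec all? (λ a → count a u ≟ℕ count a v)

-- the prefix of w of length l is abelian equivalent to the suffix of w of length l
-- (properness, l < length w, is enforced by the search below)
BorderOfLength : ℕ → Word → Set
BorderOfLength l w = AbelianEq (take l w) (drop (length w ∸ l) w)

borderOfLength? : (l : ℕ) (w : Word) → Dec (BorderOfLength l w)
borderOfLength? l w = abelianEq? (take l w) (drop (length w ∸ l) w)

searchBorder : Word → ℕ → ℕ
searchBorder w zero = 0
searchBorder w (suc k) = if does (borderOfLength? k w) then k else searchBorder w k

longestAbelianBorder : Word → ℕ
longestAbelianBorder w = searchBorder w (length w)

-- abelian border array π_x : π_x[i] = longest abelian border of x[1..i], i = 1..n
abelianBorderArray : Word → List ℕ
abelianBorderArray x = applyUpTo (λ i → longestAbelianBorder (take (suc i) x)) (length x)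

wordsOfLength : ℕ → List Word
wordsOfLength zero = [] ∷ []
wordsOfLength (suc n) = concatMap (λ w → map (_∷ w) (allFin 3)) (wordsOfLength n)

T : ℕ → ℕ
T n = length (deduplicate (≡-dec _≟ℕ_) (map abelianBorderArray (wordsOfLength n)))

{-# OPTIONS --safe #-}
-- Renaming the letters of a word by a permutation of Σ preserves all letter counts up to
-- relabelling, hence abelian equivalence, hence the abelian border array. Renaming first the
-- first letter to 0 and then, by a permutation fixing 0, the first letter other than 0 to 1,
-- every word of length m + 1 has the border array of a word 0v with v normal: v is empty,
-- v = 0v' with v' normal, or v = 1u with u arbitrary. The number N m of normal words of length m
-- satisfies N 0 = 1 and N (m + 1) = N m + 3^m, i.e. 2 N m = 3^m + 1.
module Submission where

open import Defs
open import Data.Nat using (ℕ; zero; suc; _+_; _*_; _^_; _≤_; _∸_; s<s)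
open import Data.Nat.Properties using (≰⇒>; *-suc; *-distribˡ-+; *-monoʳ-≤; module ≤-Reasoning)
  renaming (_≤?_ to _≤ℕ?_; _≟_ to _≟ℕ_)
open import Data.Fin using (Fin; zero; suc; _<_)
open import Data.Fin.Properties using (pigeonhole) renaming (_≟_ to _≟ᶠ_)
open import Data.Fin.Permutation using (Permutation′; _⟨$⟩ʳ_; _⟨$⟩ˡ_; inverseˡ; inverseʳ; id; transpose)
open import Data.List using (List; []; _∷_; length; lookup; take; drop; map; concatMap; allFin; deduplicate; applyUpTo; upTo; _++_)
open import Data.List.Properties using (≡-dec; length-map; length-++; map-cong; map-upTo; take-map; drop-map)
open import Data.List.Membership.Propositional using (_∈_; find)
open import Data.List.Membership.Propositional.Properties
  using (∈-lookup; ∈-allFin; ∈-map⁺; ∈-map⁻; ∈-++⁺ˡ; ∈-++⁺ʳ; ∈-concatMap⁺; ∈-concatMap⁻; ∈-deduplicate⁻)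
open import Data.List.Relation.Unary.Any as Any using (here; there; index)
open import Data.List.Relation.Unary.Any.Properties using (lookup-index)
open import Data.List.Relation.Unary.AllPairs using (AllPairs; _∷_)
import Data.List.Relation.Unary.All as All
open import Data.List.Relation.Unary.Unique.Propositional using (Unique)
open import Data.List.Relation.Unary.Unique.DecPropositional.Properties using (deduplicate-!)
open import Data.Product using (_×_; _,_; ∃-syntax)
open import Data.Bool using (true; false)
open import Data.Nat.Tactic.RingSolver using (solve-∀)
open import Function using (_∘_; _⇔_; mk⇔)
open import Relation.Binary.Definitions using (DecidableEquality)
open import Relation.Binary.PropositionalEquality
open import Relation.Nullary using (yes; no; does; contradiction)
open import Relation.Nullary.Decidable using (does-⇔; dec-true)

module _ {A : Set} where

  lookup-allPairs : ∀ {R : A → A → Set} {xs} → AllPairs R xs →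
                    ∀ {i j} → i < j → R (lookup xs i) (lookup xs j)
  lookup-allPairs (r ∷ _)  {zero}  {suc j} _         = All.lookup r (∈-lookup j)
  lookup-allPairs (_ ∷ rs) {suc i} {suc j} (s<s i<j) = lookup-allPairs rs i<j

  -- A unique list injects, by position, into any list containing it; pigeonhole does the rest.
  unique-⊆⇒length≤ : ∀ {xs ys : List A} → Unique xs → (∀ {x} → x ∈ xs → x ∈ ys) →
                     length xs ≤ length ys
  unique-⊆⇒length≤ {xs} {ys} uniq sub with length xs ≤ℕ? length ys
  ... | yes xs≤ys = xs≤ys
  ... | no xs≰ys =
    let i , j , i<j , same = pigeonhole (≰⇒> xs≰ys) (index ∘ sub ∘ ∈-lookup)
    in contradiction
         (trans (lookup-index (sub (∈-lookup i)))
                (trans (cong (lookup ys) same) (sym (lookup-index (sub (∈-lookup j))))))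
         (lookup-allPairs uniq i<j)

  length-deduplicate≤ : (_≟_ : DecidableEquality A) {xs ys : List A} →
                        (∀ {x} → x ∈ xs → x ∈ ys) → length (deduplicate _≟_ xs) ≤ length ys
  length-deduplicate≤ _≟_ {xs} sub =
    unique-⊆⇒length≤ (deduplicate-! _≟_ xs) (sub ∘ ∈-deduplicate⁻ _≟_ xs)

applyUpTo-cong : ∀ {A : Set} {f g : ℕ → A} → f ≗ g → applyUpTo f ≗ applyUpTo g
applyUpTo-cong {f = f} {g} f≗g n = trans (sym (map-upTo f n)) (trans (map-cong f≗g (upTo n)) (map-upTo g n))

module _ (π : Permutation′ 3) where

  rename : Word → Word
  rename = map (π ⟨$⟩ʳ_)

  does-≟-rename : ∀ a b → does (π ⟨$⟩ʳ a ≟ᶠ π ⟨$⟩ʳ b) ≡ does (a ≟ᶠ b)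
  does-≟-rename a b = does-⇔ (mk⇔ injective (cong (π ⟨$⟩ʳ_))) (π ⟨$⟩ʳ a ≟ᶠ π ⟨$⟩ʳ b) (a ≟ᶠ b)
    where
    injective : π ⟨$⟩ʳ a ≡ π ⟨$⟩ʳ b → a ≡ b
    injective eq = trans (sym (inverseˡ π)) (trans (cong (π ⟨$⟩ˡ_) eq) (inverseˡ π))

  count-rename : ∀ a u → count (π ⟨$⟩ʳ a) (rename u) ≡ count a u
  count-rename a [] = refl
  count-rename a (b ∷ u) rewrite does-≟-rename a b with does (a ≟ᶠ b)
  ... | true  = cong suc (count-rename a u)
  ... | false = count-rename a u

  count-rename′ : ∀ a u → count a (rename u) ≡ count (π ⟨$⟩ˡ a) u
  count-rename′ a u = trans (cong (λ b → count b (rename u)) (sym (inverseʳ π))) (count-rename _ u)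

  abelianEq-rename : ∀ u v → AbelianEq (rename u) (rename v) ⇔ AbelianEq u v
  abelianEq-rename u v = mk⇔
    (λ (len , cnt) → trans (sym (length-map _ u)) (trans len (length-map _ v))
                   , λ a → trans (sym (count-rename a u)) (trans (cnt (π ⟨$⟩ʳ a)) (count-rename a v)))
    (λ (len , cnt) → trans (length-map _ u) (trans len (sym (length-map _ v)))
                   , λ a → trans (count-rename′ a u) (trans (cnt _) (sym (count-rename′ a v))))

  borderOfLength-rename : ∀ l w → BorderOfLength l (rename w) ⇔ BorderOfLength l w
  borderOfLength-rename l w
    rewrite length-map (π ⟨$⟩ʳ_) w | take-map {f = π ⟨$⟩ʳ_} l w | drop-map {f = π ⟨$⟩ʳ_} (length w ∸ l) w
    = abelianEq-rename (take l w) (drop (length w ∸ l) w)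

  searchBorder-rename : ∀ w k → searchBorder (rename w) k ≡ searchBorder w k
  searchBorder-rename w zero = refl
  searchBorder-rename w (suc k)
    rewrite does-⇔ (borderOfLength-rename k w) (borderOfLength? k (rename w)) (borderOfLength? k w)
          | searchBorder-rename w k
    = refl

  longestAbelianBorder-rename : ∀ w → longestAbelianBorder (rename w) ≡ longestAbelianBorder w
  longestAbelianBorder-rename w rewrite length-map (π ⟨$⟩ʳ_) w = searchBorder-rename w (length w)

  abelianBorderArray-rename : ∀ x → abelianBorderArray (rename x) ≡ abelianBorderArray x
  abelianBorderArray-rename x rewrite length-map (π ⟨$⟩ʳ_) x =
    applyUpTo-cong (λ i → trans (cong longestAbelianBorder (take-map (suc i) x))
                                (longestAbelianBorder-rename (take (suc i) x)))
                   (length x)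

extend : Word → List Word
extend w = map (_∷ w) (allFin 3)

length-wordsOfLength : ∀ n → length (wordsOfLength n) ≡ 3 ^ n
length-wordsOfLength zero    = refl
length-wordsOfLength (suc n) =
  trans (length-concatMap-extend (wordsOfLength n)) (cong (3 *_) (length-wordsOfLength n))
  where
  length-concatMap-extend : ∀ ws → length (concatMap extend ws) ≡ 3 * length ws
  length-concatMap-extend []       = refl
  length-concatMap-extend (w ∷ ws) = trans (cong (3 +_) (length-concatMap-extend ws)) (sym (*-suc 3 (length ws)))

∈-wordsOfLength⇒length : ∀ n {x} → x ∈ wordsOfLength n → length x ≡ n
∈-wordsOfLength⇒length zero    (here refl) = refl
∈-wordsOfLength⇒length (suc n) x∈
  with w , w∈ , x∈ext ← find (∈-concatMap⁻ extend {xs = wordsOfLength n} x∈)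
  with _ , _ , refl ← ∈-map⁻ (_∷ w) x∈ext
  = cong suc (∈-wordsOfLength⇒length n w∈)

length⇒∈-wordsOfLength : ∀ {n} x → length x ≡ n → x ∈ wordsOfLength n
length⇒∈-wordsOfLength []      refl = here refl
length⇒∈-wordsOfLength (a ∷ x) refl =
  ∈-concatMap⁺ extend (Any.map (λ { refl → ∈-map⁺ (_∷ x) (∈-allFin a) }) (length⇒∈-wordsOfLength x refl))

normalWords : ℕ → List Word
normalWords zero    = [] ∷ []
normalWords (suc m) = map (zero ∷_) (normalWords m) ++ map (suc zero ∷_) (wordsOfLength m)

length-normalWords : ∀ m → 2 * length (normalWords m) ≡ 3 ^ m + 1
length-normalWords zero    = refl
length-normalWords (suc m) = begin
  2 * length (normalWords (suc m))
    ≡⟨ cong (2 *_) (length-++ (map (zero ∷_) (normalWords m))) ⟩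
  2 * (length (map (zero ∷_) (normalWords m)) + length (map (suc zero ∷_) (wordsOfLength m)))
    ≡⟨ cong (2 *_) (cong₂ _+_ (length-map _ (normalWords m)) (length-map _ (wordsOfLength m))) ⟩
  2 * (length (normalWords m) + length (wordsOfLength m))
    ≡⟨ cong (λ k → 2 * (length (normalWords m) + k)) (length-wordsOfLength m) ⟩
  2 * (length (normalWords m) + 3 ^ m)
    ≡⟨ *-distribˡ-+ 2 (length (normalWords m)) (3 ^ m) ⟩
  2 * length (normalWords m) + 2 * 3 ^ m
    ≡⟨ cong (_+ 2 * 3 ^ m) (length-normalWords m) ⟩
  3 ^ m + 1 + 2 * 3 ^ m
    ≡⟨ regroup (3 ^ m) ⟩
  3 * 3 ^ m + 1
    ∎
  where
  open ≡-Reasoning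
  regroup : ∀ k → k + 1 + 2 * k ≡ 3 * k + 1
  regroup = solve-∀

1∷-∈-normalWords : ∀ {m} u → length u ≡ m → (suc zero ∷ u) ∈ normalWords (suc m)
1∷-∈-normalWords u len = ∈-++⁺ʳ _ (∈-map⁺ (suc zero ∷_) (length⇒∈-wordsOfLength u len))

normalise : ∀ v → ∃[ π ] (π ⟨$⟩ʳ zero ≡ zero × rename π v ∈ normalWords (length v))
normalise []                   = id , refl , here refl
normalise (zero ∷ v)
  with π , π0≡0 , πv∈ ← normalise v
  = π , π0≡0 , subst (λ a → (a ∷ rename π v) ∈ normalWords (suc (length v))) (sym π0≡0)
                     (∈-++⁺ˡ (∈-map⁺ (zero ∷_) πv∈))
normalise (suc zero ∷ v)       = id , refl , 1∷-∈-normalWords (rename id v) (length-map _ v)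
normalise (suc (suc zero) ∷ v) = swap12 , refl , 1∷-∈-normalWords (rename swap12 v) (length-map _ v)
  where
  swap12 : Permutation′ 3
  swap12 = transpose (suc zero) (suc (suc zero))

transpose-sends : ∀ {n} (i j : Fin n) → transpose i j ⟨$⟩ʳ i ≡ j
transpose-sends i j rewrite dec-true (i ≟ᶠ i) refl = refl

normalForm : ∀ {m} x → length x ≡ suc m →
             ∃[ y ] (y ∈ map (zero ∷_) (normalWords m) × abelianBorderArray y ≡ abelianBorderArray x)
normalForm (a ∷ w) refl
  with τ , τ0≡0 , τσw∈ ← normalise (rename (transpose a zero) w)
  = zero ∷ rename τ (rename σ w)
  , ∈-map⁺ (zero ∷_) (subst (λ k → rename τ (rename σ w) ∈ normalWords k) (length-map _ w) τσw∈)
  , (begin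
      abelianBorderArray (zero ∷ rename τ (rename σ w))
        ≡⟨ cong (λ b → abelianBorderArray (b ∷ rename τ (rename σ w))) (sym σa↦0) ⟩
      abelianBorderArray (rename τ (rename σ (a ∷ w)))
        ≡⟨ abelianBorderArray-rename τ (rename σ (a ∷ w)) ⟩
      abelianBorderArray (rename σ (a ∷ w))
        ≡⟨ abelianBorderArray-rename σ (a ∷ w) ⟩
      abelianBorderArray (a ∷ w)
        ∎)
  where
  open ≡-Reasoning
  σ : Permutation′ 3
  σ = transpose a zero
  σa↦0 : τ ⟨$⟩ʳ (σ ⟨$⟩ʳ a) ≡ zero
  σa↦0 = trans (cong (τ ⟨$⟩ʳ_) (transpose-sends a zero)) τ0≡0

abelianBorderArrays⊆normal : ∀ m {p} → p ∈ map abelianBorderArray (wordsOfLength (suc m)) →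
                             p ∈ map abelianBorderArray (map (zero ∷_) (normalWords m))
abelianBorderArrays⊆normal m p∈
  with x , x∈ , refl ← ∈-map⁻ abelianBorderArray p∈
  with y , y∈ , same ← normalForm x (∈-wordsOfLength⇒length (suc m) x∈)
  = subst (_∈ map abelianBorderArray (map (zero ∷_) (normalWords m))) same
          (∈-map⁺ abelianBorderArray y∈)

mainTheorem10 : (n : ℕ) → 1 ≤ n → 2 * T n ≤ 3 ^ (n ∸ 1) + 1
mainTheorem10 (suc m) _ = begin
  2 * T (suc m)
    ≤⟨ *-monoʳ-≤ 2 (length-deduplicate≤ (≡-dec _≟ℕ_) (abelianBorderArrays⊆normal m)) ⟩
  2 * length (map abelianBorderArray (map (zero ∷_) (normalWords m)))
    ≡⟨ cong (2 *_) (trans (length-map abelianBorderArray (map (zero ∷_) (normalWords m)))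
                         (length-map (zero ∷_) (normalWords m))) ⟩
  2 * length (normalWords m)
    ≡⟨ length-normalWords m ⟩
  3 ^ m + 1
    ∎
  where open ≤-Reasoning
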